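{- Let $k$ and $j$ be positive integers. For every graph $G$, every resolving set $S$ of $G$ with $|S|=k$, and every $v\in S$, the number of vertices $u\ne v$ with $\textnormal{dist}(u,v)=j$ is at most $(2j+1)^{k-1}$; moreover, there exist a graph $G$, a resolving set $S$ of $G$ with $|S|=k$, and $v\in S$ for which this number equals $(2j+1)^{k-1}$.
   Context: Graphs are finite, simple, undirected, possibly disconnected; $\textnormal{dist}(u,v)=\infty$ between different components. A set $S=\{v_1,\dots,v_k\}$ of vertices is a resolving set of $G$ if the vectors $(\textnormal{dist}(u,v_1),\dots,\textnormal{dist}(u,v_k))$ are pairwise distinct over $u\in V(G)$. -}

module Defs where

open import Data.Nat using (ℕ; zero; suc; _≤_; _+_; _*_; _^_; _∸_)
open import Data.Fin using (Fin)
open import Data.Bool using (Bool; true; false)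
open import Data.Maybe using (Maybe; just; nothing)
open import Data.Product using (_×_; Σ; _,_)
open import Data.List using (List; length)
open import Data.List.Membership.Propositional using (_∈_)
open import Data.List.Relation.Unary.Unique.Propositional using (Unique)
open import Relation.Binary.PropositionalEquality using (_≡_; _≢_)
open import Relation.Nullary using (¬_)
open import Function.Bundles using (_⇔_)

record Graph : Set where
  field
    n     : ℕ
    adj   : Fin n → Fin n → Bool
    sym   : ∀ u v → adj u v ≡ adj v u
    irrefl : ∀ u → adj u u ≡ false

open Graph public

Vertex : Graph → Set
Vertex G = Fin (n G)

data Walk (G : Graph) : Vertex G → Vertex G → ℕ → Set where
  here : ∀ {u} → Walk G u u zero
  step : ∀ {u w v d} → adj G u w ≡ true → Walk G w v d → Walk G u v (suc d)

-- Extended naturals: nothing = ∞ (different components).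
ℕ∞ : Set
ℕ∞ = Maybe ℕ

Dist : (G : Graph) → Vertex G → Vertex G → ℕ∞ → Set
Dist G u v (just d) = Walk G u v d × (∀ d' → Walk G u v d' → d ≤ d')
Dist G u v nothing  = ∀ d → ¬ Walk G u v d

Resolving : (G : Graph) → List (Vertex G) → Set
Resolving G S = ∀ u w → (∀ s → s ∈ S → ∀ x → Dist G u s x → Dist G w s x) → u ≡ w

AtDist : (G : Graph) → Vertex G → ℕ → Vertex G → Set
AtDist G v j u = u ≢ v × Dist G u v (just j)

module Submission where

-- If u is at distance j from v and a landmark s is at distance d from v, then dist(u,s) lies in
-- [d - j, d + j] (and if v does not reach s, neither does u). Since S resolves G and the
-- coordinate for v itself is constant on such u, the k - 1 offsets dist(u,s) - d + j ∈ [0, 2j]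
-- determine u, whence at most (2j + 1)^(k-1) such vertices.
--
-- For equality, take the integer points x ∈ [0, 3j]^k with |x_i - x_l| ≤ 2j ≤ x_i + x_l for
-- i ≠ l, adjacent when they differ by at most 1 in every coordinate, and the landmarks s_i with
-- coordinates 0 at i and 2j elsewhere. Then dist(x, s_i) = x_i: coordinates are 1-Lipschitz
-- along edges, and from x one can always lower x_i by one while clamping every other
-- coordinate into [2j - x_i + 1, x_i - 1 + 2j]. So the vertices at distance j from s_1 are the
-- points with x_1 = j and all other coordinates in [j, 3j], and there are (2j + 1)^(k-1) of them.

open import Defs
import Data.Nat as ℕ
open import Data.Nat using (ℕ; zero; suc; _≤_; _<_; _+_; _*_; _^_; _∸_; _⊔_; _⊓_; NonZero; z≤n; s≤s; _≤?_)
open import Data.Nat.Properties hiding (_≟_)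
open import Data.Nat.Tactic.RingSolver using (solve-∀)
open import Data.Bool using (true)
import Data.Bool.Properties as Bool
open import Data.Fin using (Fin; zero; suc; toℕ; fromℕ<; _≟_; combine; funToFin; finToFun)
open import Data.Fin.Properties using (any?; all?; toℕ<n; toℕ-fromℕ<; toℕ-injective; injective⇒≤; finToFun-funToFin; funToFin-finToFin)
open import Data.Maybe using (just; nothing)
open import Data.Maybe.Properties using (just-injective)
open import Data.List using (List; []; _∷_; _++_; length; lookup; filter; allFin; map)
open import Data.List.Properties using (length-++-sucʳ; length-map; length-tabulate)
open import Data.List.Membership.Propositional using (_∈_)
open import Data.List.Membership.Propositional.Properties using (∈-∃++; ∈-lookup; ∈-filter⁺; ∈-filter⁻; ∈-allFin; ∈-map⁺)
open import Data.List.Relation.Unary.Any using (here; there; index)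
open import Data.List.Relation.Unary.Any.Properties using (lookup-index)
open import Data.List.Relation.Unary.All as All using (All)
open import Data.List.Relation.Unary.Unique.Propositional using (Unique)
open import Data.List.Relation.Unary.AllPairs using (_∷_)
import Data.List.Relation.Unary.Unique.Propositional.Properties as Unique
import Data.Product as Product
open import Data.Product using (_×_; Σ-syntax; ∃; _,_; proj₁; proj₂)
open import Data.Sum as Sum using (_⊎_; inj₁; inj₂)
open import Function using (_∘_; id; Injective; _⇔_; mk⇔; Equivalence)
open import Level using (0ℓ)
open import Relation.Nullary using (¬_; ¬?; Dec; does; yes; no; _×-dec_; contradiction)
open import Relation.Nullary.Decidable
  using (map′; _→-dec_; decidable-stable; ¬¬-excluded-middle; does-⇔; dec-true; dec-false; toWitness; isYes≗does)
open import Relation.Nullary.Negation using (¬¬-Monad; ¬¬-map)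
open import Relation.Unary using (Pred; Decidable)
open import Relation.Binary.PropositionalEquality as ≡ using (_≡_; _≢_; refl; cong; cong₂; subst; subst₂; _≗_)

least-witness : ∀ {p} {P : Pred ℕ p} → Decidable P → ∀ {n} → P n →
                Σ[ m ∈ ℕ ] P m × (∀ k → P k → m ≤ k)
least-witness P? {n} pn with P? 0
... | yes p0 = 0 , p0 , λ _ _ → z≤n
least-witness P? {zero}  pn | no ¬p0 = contradiction pn ¬p0
least-witness P? {suc n} pn | no ¬p0 with least-witness (P? ∘ suc) pn
... | m , pm , m-least = suc m , pm , λ { zero p0 → contradiction p0 ¬p0
                                        ; (suc k) pk → s≤s (m-least k pk) }

lookup-injective : ∀ {a} {A : Set a} {xs : List A} → Unique xs → Injective _≡_ _≡_ (lookup xs)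
lookup-injective {xs = x ∷ xs} (x∉xs ∷ _) {zero}  {zero}  _ = refl
lookup-injective {xs = x ∷ xs} (x∉xs ∷ _) {zero}  {suc i} x≡ =
  contradiction x≡ (All.lookup x∉xs (∈-lookup i))
lookup-injective {xs = x ∷ xs} (x∉xs ∷ _) {suc i} {zero}  ≡x =
  contradiction (≡.sym ≡x) (All.lookup x∉xs (∈-lookup i))
lookup-injective {xs = x ∷ xs} (_ ∷ uxs)  {suc i} {suc i′} eq = cong suc (lookup-injective uxs eq)

funToFin-cong : ∀ {m n} {f g : Fin m → Fin n} → f ≗ g → funToFin f ≡ funToFin g
funToFin-cong {zero}  f≗g = refl
funToFin-cong {suc m} f≗g = cong₂ combine (f≗g zero) (funToFin-cong (f≗g ∘ suc))

funToFin-injective : ∀ {m n} {f g : Fin m → Fin n} → funToFin f ≡ funToFin g → f ≗ g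
funToFin-injective {f = f} {g} eq i =
  ≡.trans (≡.sym (finToFun-funToFin f i)) (≡.trans (cong (λ c → finToFun c i) eq) (finToFun-funToFin g i))

finToFun-injective : ∀ {m n} {a b : Fin (m ^ n)} → finToFun a ≗ finToFun b → a ≡ b
finToFun-injective {m} {n} {a} {b} eq =
  ≡.trans (≡.sym (funToFin-finToFin {n} a)) (≡.trans (funToFin-cong {n} {m} eq) (funToFin-finToFin {n} b))

suc[j+j]≡2*j+1 : ∀ j → suc (j + j) ≡ 2 * j + 1
suc[j+j]≡2*j+1 = solve-∀

∈-++-∷⁻ : ∀ {a} {A : Set a} (xs : List A) {y ys z} → z ∈ xs ++ y ∷ ys → z ≡ y ⊎ z ∈ xs ++ ys
∈-++-∷⁻ []       (here z≡y) = inj₁ z≡y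
∈-++-∷⁻ []       (there z∈) = inj₂ z∈
∈-++-∷⁻ (x ∷ xs) (here z≡x) = inj₂ (here z≡x)
∈-++-∷⁻ (x ∷ xs) (there z∈) = Sum.map₂ there (∈-++-∷⁻ xs z∈)

module _ {G : Graph} where

  infixr 5 _++ʷ_
  _++ʷ_ : ∀ {u w s a b} → Walk G u w a → Walk G w s b → Walk G u s (a + b)
  here     ++ʷ q = q
  step e p ++ʷ q = step e (p ++ʷ q)

  reverseʷ : ∀ {u w a} → Walk G u w a → Walk G w u a
  reverseʷ here = here
  reverseʷ {a = suc a} (step {u} {x} e p) =
    subst (Walk G _ u) (+-comm a 1) (reverseʷ p ++ʷ step (≡.trans (sym G x u) e) here)

  walk? : ∀ d u s → Dec (Walk G u s d)
  walk? zero    u s = map′ (λ { refl → here }) (λ { here → refl }) (u ≟ s)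
  walk? (suc d) u s = map′ (λ (_ , e , p) → step e p) (λ { (step e p) → _ , e , p })
                        (any? λ w → (adj G u w Bool.≟ true) ×-dec walk? d w s)

  walk⇒Dist : ∀ {u s d} → Walk G u s d → ∃ λ e → Dist G u s (just e)
  walk⇒Dist {u} {s} = least-witness (λ d → walk? d u s)

  Dist-unique : ∀ {u s x y} → Dist G u s x → Dist G u s y → x ≡ y
  Dist-unique {x = just a} {just b} (p , p-min) (q , q-min) = cong just (≤-antisym (p-min b q) (q-min a p))
  Dist-unique {x = just a} {nothing} (p , _) ¬q = contradiction p (¬q a)
  Dist-unique {x = nothing} {just b} ¬p (q , _) = contradiction q (¬p b)
  Dist-unique {x = nothing} {nothing} _ _ = refl

  Dist-transfer : ∀ {u w s x y} → Dist G u s y → Dist G w s y → Dist G u s x → Dist G w s x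
  Dist-transfer du dw dx = subst (Dist G _ _) (Dist-unique du dx) dw

module AtDistanceBound {G : Graph} (v : Vertex G) (j : ℕ) where

  Reach : Pred (Vertex G) 0ℓ
  Reach s = ∃ λ d → Dist G v s (just d)

  reach-from : ∀ {u s} → AtDist G v j u → Reach s → ∃ λ e → Dist G u s (just e)
  reach-from (_ , p , _) (_ , q , _) = walk⇒Dist (p ++ʷ q)

  unreachable-from : ∀ {u s} → AtDist G v j u → ¬ Reach s → Dist G u s nothing
  unreachable-from (_ , p , _) ¬r d q = ¬r (walk⇒Dist (reverseʷ p ++ʷ q))

  -- Junk value 0 when v does not reach s: then no vertex at distance j from v does either.
  offset : ∀ {s u} → Dec (Reach s) → AtDist G v j u → ℕ
  offset (yes r@(d , _)) au = j + proj₁ (reach-from au r) ∸ d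
  offset (no _)          _  = 0

  offset≤ : ∀ {s u} (r? : Dec (Reach s)) (au : AtDist G v j u) → offset r? au ≤ j + j
  offset≤ (no _) _ = z≤n
  offset≤ (yes r@(d , q , _)) au@(_ , p , _) with reach-from au r
  ... | e , _ , e-min = begin
    j + e ∸ d       ≤⟨ ∸-monoˡ-≤ d (+-monoʳ-≤ j (e-min (j + d) (p ++ʷ q))) ⟩
    j + (j + d) ∸ d ≡⟨ cong (_∸ d) (≡.sym (+-assoc j j d)) ⟩
    j + j + d ∸ d   ≡⟨ m+n∸n≡m (j + j) d ⟩
    j + j           ∎
    where open ≤-Reasoning

  offset+d : ∀ {s u} (r : Reach s) (au : AtDist G v j u) →
             offset (yes r) au + proj₁ r ≡ j + proj₁ (reach-from au r)
  offset+d (d , q , d-min) au@(_ , p , _) with reach-from au (d , q , d-min)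
  ... | e , q′ , _ = m∸n+n≡m (d-min (j + e) (reverseʷ p ++ʷ q′))

  offset-transfer : ∀ {s u w} (r? : Dec (Reach s)) (au : AtDist G v j u) (aw : AtDist G v j w) →
                    offset r? au ≡ offset r? aw → ∀ x → Dist G u s x → Dist G w s x
  offset-transfer (no ¬r) au aw _ x = Dist-transfer (unreachable-from au ¬r) (unreachable-from aw ¬r)
  offset-transfer (yes r) au aw eq x =
    Dist-transfer (proj₂ (reach-from au r))
                  (subst (λ e → Dist G _ _ (just e)) (≡.sym same) (proj₂ (reach-from aw r)))
    where
    same : proj₁ (reach-from au r) ≡ proj₁ (reach-from aw r)
    same = +-cancelˡ-≡ j _ _ (begin
      j + proj₁ (reach-from au r) ≡⟨ ≡.sym (offset+d r au) ⟩
      offset (yes r) au + proj₁ r ≡⟨ cong (_+ proj₁ r) eq ⟩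
      offset (yes r) aw + proj₁ r ≡⟨ offset+d r aw ⟩
      j + proj₁ (reach-from aw r) ∎)
      where open ≡.≡-Reasoning

  -- Reachability from v is not decided; as the conclusion is a decidable inequality, we may
  -- argue under a double negation instead.
  atDist-bound-++ : ∀ (S₁ S₂ : List (Vertex G)) {L} → Resolving G (S₁ ++ v ∷ S₂) → Unique L →
                    All (AtDist G v j) L → length L ≤ suc (j + j) ^ length (S₁ ++ S₂)
  atDist-bound-++ S₁ S₂ {L} resolving uL atL =
    decidable-stable (_ ≤? _)
      (¬¬-map count (All.sequenceM 0ℓ ¬¬-Monad (All.universal (λ _ → ¬¬-excluded-middle) S′)))
    where
    S′ = S₁ ++ S₂

    count : All (Dec ∘ Reach) S′ → length L ≤ suc (j + j) ^ length S′
    count reach? = injective⇒≤ {f = code} code-injective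
      where
      at : (i : Fin (length L)) → AtDist G v j (lookup L i)
      at i = All.lookup atL (∈-lookup i)

      reach?ₜ : (t : Fin (length S′)) → Dec (Reach (lookup S′ t))
      reach?ₜ t = All.lookup reach? (∈-lookup t)

      code : Fin (length L) → Fin (suc (j + j) ^ length S′)
      code i = funToFin λ t → fromℕ< (s≤s (offset≤ (reach?ₜ t) (at i)))

      code-injective : Injective _≡_ _≡_ code
      code-injective {i} {i′} eq = lookup-injective uL (resolving _ _ same-distances)
        where
        same-offset : ∀ t → offset (reach?ₜ t) (at i) ≡ offset (reach?ₜ t) (at i′)
        same-offset t = ≡.trans (≡.sym (toℕ-fromℕ< _))
                          (≡.trans (cong toℕ (funToFin-injective eq t)) (toℕ-fromℕ< _))

        same-distances : ∀ s → s ∈ S₁ ++ v ∷ S₂ →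
                         ∀ x → Dist G (lookup L i) s x → Dist G (lookup L i′) s x
        same-distances s s∈S with ∈-++-∷⁻ S₁ s∈S
        ... | inj₁ refl = λ x → Dist-transfer (proj₂ (at i)) (proj₂ (at i′))
        ... | inj₂ s∈S′ = subst (λ z → ∀ x → Dist G (lookup L i) z x → Dist G (lookup L i′) z x)
                            (≡.sym (lookup-index s∈S′))
                            (offset-transfer (reach?ₜ t) (at i) (at i′) (same-offset t))
          where t = index s∈S′

  atDist-bound : ∀ {S L} → Resolving G S → v ∈ S → Unique L → All (AtDist G v j) L →
                 length L ≤ (2 * j + 1) ^ (length S ∸ 1)
  atDist-bound {L = L} resolving v∈S uL atL with ∈-∃++ v∈S
  ... | S₁ , S₂ , refl =
    subst₂ (λ b m → length L ≤ b ^ m) (suc[j+j]≡2*j+1 j) (≡.sym (cong (_∸ 1) (length-++-sucʳ S₁ v S₂)))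
           (atDist-bound-++ S₁ S₂ resolving uL atL)

-- Tri E a b: a and b can be the distances from one point to two points at distance E.
Tri : ℕ → ℕ → ℕ → Set
Tri E a b = a ≤ b + E × b ≤ a + E × E ≤ a + b

Tri? : ∀ E a b → Dec (Tri E a b)
Tri? E a b = (a ≤? b + E) ×-dec (b ≤? a + E) ×-dec (E ≤? a + b)

Tri-sym : ∀ {E a b} → Tri E a b → Tri E b a
Tri-sym {E} {a} {b} (a≤ , b≤ , E≤) = b≤ , a≤ , subst (E ≤_) (+-comm a b) E≤

module Clamp (E a : ℕ) where

  clamp : ℕ → ℕ
  clamp c = (c ⊔ (E ∸ a)) ⊓ (a + E)

  private
    ⊓≤clamp : ∀ c → c ⊓ (a + E) ≤ clamp c
    ⊓≤clamp c = ⊓-mono-≤ (m≤m⊔n c (E ∸ a)) ≤-refl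

    E∸a≤clamp : ∀ c → E ∸ a ≤ clamp c
    E∸a≤clamp c = ⊓-glb (m≤n⊔m c (E ∸ a)) (≤-trans (m∸n≤m E a) (m≤n+m E a))

    clamp≤⊔ : ∀ c → clamp c ≤ c ⊔ (E ∸ a)
    clamp≤⊔ c = m⊓n≤m _ (a + E)

    clamp-nonexpansive : ∀ c c′ → c ≤ c′ + E → clamp c ≤ clamp c′ + E
    clamp-nonexpansive c c′ c≤ = subst (clamp c ≤_) (≡.sym (+-distribʳ-⊓ E (c′ ⊔ (E ∸ a)) (a + E)))
      (⊓-mono-≤ (⊔-lub (≤-trans c≤ (+-monoˡ-≤ E (m≤m⊔n c′ (E ∸ a))))
                        (≤-trans (m≤n⊔m c′ (E ∸ a)) (m≤m+n _ E)))
                (m≤m+n (a + E) E))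

    E≤⊓-or-⊓≡ : ∀ c → E ≤ c ⊓ (a + E) ⊎ c ⊓ (a + E) ≡ c
    E≤⊓-or-⊓≡ c with c ≤? a + E
    ... | yes c≤ = inj₂ (m≤n⇒m⊓n≡m c≤)
    ... | no  c≰ = inj₁ (subst (E ≤_) (≡.sym (m≥n⇒m⊓n≡n (<⇒≤ (≰⇒> c≰)))) (m≤n+m E a))

    clamp-sum : ∀ c c′ → E ≤ c + c′ → E ≤ clamp c + clamp c′
    clamp-sum c c′ E≤ =
      ≤-trans (cases (E≤⊓-or-⊓≡ c) (E≤⊓-or-⊓≡ c′)) (+-mono-≤ (⊓≤clamp c) (⊓≤clamp c′))
      where
      cases : _ → _ → E ≤ c ⊓ (a + E) + c′ ⊓ (a + E)
      cases (inj₁ E≤⊓) _             = ≤-trans E≤⊓ (m≤m+n _ _)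
      cases (inj₂ _)  (inj₁ E≤⊓′)   = ≤-trans E≤⊓′ (m≤n+m _ _)
      cases (inj₂ eq) (inj₂ eq′)    = subst (E ≤_) (≡.sym (cong₂ _+_ eq eq′)) E≤

  Tri-clamp : ∀ {c c′} → Tri E c c′ → Tri E (clamp c) (clamp c′)
  Tri-clamp {c} {c′} (c≤ , c′≤ , E≤) =
    clamp-nonexpansive c c′ c≤ , clamp-nonexpansive c′ c c′≤ , clamp-sum c c′ E≤

  Tri-clamp-step : ∀ {c} → Tri E (suc a) c → Tri E a (clamp c)
  Tri-clamp-step {c} (a<c+E , c≤ , E≤) =
    ≤-trans (subst (a ≤_) (≡.sym (+-distribʳ-⊓ E c (a + E)))
               (⊓-glb (≤-trans (n≤1+n a) a<c+E) (≤-trans (m≤m+n a E) (m≤m+n (a + E) E))))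
            (+-monoˡ-≤ E (⊓≤clamp c)) ,
    m⊓n≤n _ (a + E) ,
    ≤-trans (m≤n+m∸n E a) (+-monoʳ-≤ a (E∸a≤clamp c))

  clamp-near : ∀ {c} → Tri E (suc a) c → clamp c ≤ suc c × c ≤ suc (clamp c)
  clamp-near {c} (_ , c≤ , E≤) =
    ≤-trans (clamp≤⊔ c) (⊔-lub (n≤1+n c) (m≤n+o⇒m∸n≤o E a (subst (E ≤_) (≡.sym (+-suc a c)) E≤))) ,
    ≤-trans (⊓-glb (n≤1+n c) c≤) (s≤s (⊓≤clamp c))

  clamp-bounded : ∀ {c b} → c ≤ b → E ≤ b → clamp c ≤ b
  clamp-bounded c≤b E≤b = ≤-trans (clamp≤⊔ _) (⊔-lub c≤b (≤-trans (m∸n≤m E a) E≤b))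

module Extremal (m j′ : ℕ) where

  j K E B : ℕ
  j = suc j′
  K = suc m
  E = j + j
  B = E + j

  Valid : (Fin K → ℕ) → Set
  Valid f = ∀ i l → i ≢ l → Tri E (f i) (f l)

  valid? : ∀ f → Dec (Valid f)
  valid? f = all? λ i → all? λ l → ¬? (i ≟ l) →-dec Tri? E (f i) (f l)

  Cell : Set
  Cell = Fin (suc B ^ K)

  coord : Cell → Fin K → ℕ
  coord c i = toℕ (finToFun c i)

  -- Opaque, so that the type checker never tries to normalise the enumeration of all cells.
  opaque
    cells : List Cell
    cells = filter (valid? ∘ coord) (allFin _)

  Point : Set
  Point = Fin (length cells)

  opaque
    unfolding cells

    x : Point → Fin K → ℕ
    x u = coord (lookup cells u)

    x-valid : ∀ u → Valid (x u)
    x-valid u = proj₂ (∈-filter⁻ (valid? ∘ coord) {xs = allFin _} (∈-lookup u))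

    x-injective : ∀ {u w} → x u ≗ x w → u ≡ w
    x-injective eq = lookup-injective (Unique.filter⁺ (valid? ∘ coord) (Unique.allFin⁺ _))
                                      (finToFun-injective (toℕ-injective ∘ eq))

    point : (f : Fin K → ℕ) → (∀ i → f i ≤ B) → Valid f → Σ[ u ∈ Point ] x u ≗ f
    point f f≤B f-valid = index c∈cells , x-point
      where
      digits : Fin K → Fin (suc B)
      digits i = fromℕ< (s≤s (f≤B i))

      c : Cell
      c = funToFin digits

      coord-c : coord c ≗ f
      coord-c i = ≡.trans (cong toℕ (finToFun-funToFin digits i)) (toℕ-fromℕ< _)

      c∈cells : c ∈ cells
      c∈cells = ∈-filter⁺ (valid? ∘ coord) (∈-allFin c)
                  λ i l i≢l → subst₂ (Tri E) (≡.sym (coord-c i)) (≡.sym (coord-c l)) (f-valid i l i≢l)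

      x-point : x (index c∈cells) ≗ f
      x-point i = ≡.trans (cong (λ c′ → coord c′ i) (≡.sym (lookup-index c∈cells))) (coord-c i)

    x-bounded : ∀ u i → x u i ≤ B
    x-bounded u i = m<1+n⇒m≤n (toℕ<n (finToFun (lookup cells u) i))

  Adjacent : Point → Point → Set
  Adjacent u w = u ≢ w × (∀ i → x u i ≤ suc (x w i) × x w i ≤ suc (x u i))

  adjacent? : ∀ u w → Dec (Adjacent u w)
  adjacent? u w = ¬? (u ≟ w) ×-dec all? λ i → (x u i ≤? suc (x w i)) ×-dec (x w i ≤? suc (x u i))

  Adjacent-sym : ∀ {u w} → Adjacent u w → Adjacent w u
  Adjacent-sym (u≢w , near) = u≢w ∘ ≡.sym , λ i → proj₂ (near i) , proj₁ (near i)

  G : Graph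
  G = record
    { n      = length cells
    ; adj    = λ u w → does (adjacent? u w)
    ; sym    = λ u w → does-⇔ (mk⇔ Adjacent-sym Adjacent-sym) (adjacent? u w) (adjacent? w u)
    ; irrefl = λ u → dec-false (adjacent? u u) λ (u≢u , _) → u≢u refl
    }

  adj⇒Adjacent : ∀ {u w} → adj G u w ≡ true → Adjacent u w
  adj⇒Adjacent {u} {w} e = toWitness (Equivalence.from Bool.T-≡ (≡.trans (isYes≗does (adjacent? u w)) e))

  Adjacent⇒adj : ∀ {u w} → Adjacent u w → adj G u w ≡ true
  Adjacent⇒adj {u} {w} = dec-true (adjacent? u w)

  x-lipschitz : ∀ {u w d} i → Walk G u w d → x u i ≤ d + x w i
  x-lipschitz i here = ≤-refl
  x-lipschitz i (step e p) = ≤-trans (proj₁ (proj₂ (adj⇒Adjacent e) i)) (s≤s (x-lipschitz i p))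

  hub : Fin K → Fin K → ℕ
  hub i l with i ≟ l
  ... | yes _ = 0
  ... | no  _ = E

  hub-self : ∀ i → hub i i ≡ 0
  hub-self i with i ≟ i
  ... | yes _   = refl
  ... | no  i≢i = contradiction refl i≢i

  hub-other : ∀ {i l} → i ≢ l → hub i l ≡ E
  hub-other {i} {l} i≢l with i ≟ l
  ... | yes i≡l = contradiction i≡l i≢l
  ... | no  _   = refl

  hub-valid : ∀ i → Valid (hub i)
  hub-valid i l l′ l≢l′ with i ≟ l | i ≟ l′
  ... | yes refl | yes refl = contradiction refl l≢l′
  ... | yes _    | no  _    = z≤n , ≤-refl , ≤-refl
  ... | no  _    | yes _    = ≤-refl , z≤n , ≤-reflexive (≡.sym (+-identityʳ E))
  ... | no  _    | no  _    = m≤m+n E E , m≤m+n E E , m≤m+n E E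

  hub-bounded : ∀ i l → hub i l ≤ B
  hub-bounded i l with i ≟ l
  ... | yes _ = z≤n
  ... | no  _ = m≤m+n E j

  zero-coordinate⇒hub : ∀ {f i} → Valid f → f i ≡ 0 → f ≗ hub i
  zero-coordinate⇒hub {f} {i} f-valid fi≡0 l with i ≟ l
  ... | yes refl = fi≡0
  ... | no  i≢l with f-valid i l i≢l
  ...   | _ , fl≤ , E≤ =
    ≤-antisym (subst (λ z → f l ≤ z + E) fi≡0 fl≤) (subst (λ z → E ≤ z + f l) fi≡0 E≤)

  landmark : Fin K → Point
  landmark i = proj₁ (point (hub i) (hub-bounded i) (hub-valid i))

  x-landmark : ∀ i → x (landmark i) ≗ hub i
  x-landmark i = proj₂ (point (hub i) (hub-bounded i) (hub-valid i))

  x-landmark-self : ∀ i → x (landmark i) i ≡ 0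
  x-landmark-self i = ≡.trans (x-landmark i i) (hub-self i)

  descend : ∀ {u i a} → x u i ≡ suc a → Σ[ w ∈ Point ] adj G u w ≡ true × x w i ≡ a
  descend {u} {i} {a} xᵢ≡1+a = w , Adjacent⇒adj (u≢w , near-w) , ≡.trans (x-w i) y-i
    where
    open Clamp E a

    y : Fin K → ℕ
    y l with l ≟ i
    ... | yes _ = a
    ... | no  _ = clamp (x u l)

    y-i : y i ≡ a
    y-i with i ≟ i
    ... | yes _   = refl
    ... | no  i≢i = contradiction refl i≢i

    Tri-i : ∀ {l} → l ≢ i → Tri E (suc a) (x u l)
    Tri-i l≢i = subst (λ z → Tri E z _) xᵢ≡1+a (x-valid u i _ (l≢i ∘ ≡.sym))

    y-valid : Valid y
    y-valid l l′ l≢l′ with l ≟ i | l′ ≟ i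
    ... | yes refl | yes refl = contradiction refl l≢l′
    ... | yes refl | no  l′≢i = Tri-clamp-step (Tri-i l′≢i)
    ... | no  l≢i  | yes refl = Tri-sym (Tri-clamp-step (Tri-i l≢i))
    ... | no  _    | no  _    = Tri-clamp (x-valid u l l′ l≢l′)

    y-bounded : ∀ l → y l ≤ B
    y-bounded l with l ≟ i
    ... | yes refl = ≤-trans (n≤1+n a) (subst (_≤ B) xᵢ≡1+a (x-bounded u i))
    ... | no  _    = clamp-bounded (x-bounded u l) (m≤m+n E j)

    near : ∀ l → x u l ≤ suc (y l) × y l ≤ suc (x u l)
    near l with l ≟ i
    ... | yes refl = ≤-reflexive xᵢ≡1+a ,
                     ≤-trans (n≤1+n a) (≤-trans (≤-reflexive (≡.sym xᵢ≡1+a)) (n≤1+n _))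
    ... | no  l≢i  = Product.swap (clamp-near (Tri-i l≢i))

    w : Point
    w = proj₁ (point y y-bounded y-valid)

    x-w : x w ≗ y
    x-w = proj₂ (point y y-bounded y-valid)

    near-w : ∀ l → x u l ≤ suc (x w l) × x w l ≤ suc (x u l)
    near-w l = subst (λ z → x u l ≤ suc z × z ≤ suc (x u l)) (≡.sym (x-w l)) (near l)

    u≢w : u ≢ w
    u≢w u≡w = 1+n≢n (begin
      suc a ≡⟨ ≡.sym xᵢ≡1+a ⟩
      x u i ≡⟨ cong (λ z → x z i) u≡w ⟩
      x w i ≡⟨ x-w i ⟩
      y i   ≡⟨ y-i ⟩
      a     ∎)
      where open ≡.≡-Reasoning

  walk-to-landmark : ∀ i a u → x u i ≡ a → Walk G u (landmark i) a
  walk-to-landmark i zero u xᵢ≡0 =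
    subst (λ w → Walk G u w 0)
          (x-injective λ l → ≡.trans (zero-coordinate⇒hub (x-valid u) xᵢ≡0 l) (≡.sym (x-landmark i l)))
          here
  walk-to-landmark i (suc a) u xᵢ≡1+a with descend xᵢ≡1+a
  ... | w , u~w , xᵢ≡a = step u~w (walk-to-landmark i a w xᵢ≡a)

  dist-to-landmark : ∀ u i → Dist G u (landmark i) (just (x u i))
  dist-to-landmark u i = walk-to-landmark i (x u i) u refl , λ d p →
    ≤-trans (x-lipschitz i p) (≤-reflexive (≡.trans (cong (d +_) (x-landmark-self i)) (+-identityʳ d)))

  landmarks : List Point
  landmarks = map landmark (allFin K)

  landmarks-unique : Unique landmarks
  landmarks-unique = Unique.map⁺ landmark-injective (Unique.allFin⁺ K)
    where
    landmark-injective : ∀ {i l} → landmark i ≡ landmark l → i ≡ l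
    landmark-injective {i} {l} eq with i ≟ l
    ... | yes i≡l = i≡l
    ... | no  i≢l = contradiction (begin
      0                ≡⟨ ≡.sym (x-landmark-self i) ⟩
      x (landmark i) i ≡⟨ cong (λ w → x w i) eq ⟩
      x (landmark l) i ≡⟨ x-landmark l i ⟩
      hub l i          ≡⟨ hub-other (i≢l ∘ ≡.sym) ⟩
      E                ∎) λ ()
      where open ≡.≡-Reasoning

  landmark∈landmarks : ∀ i → landmark i ∈ landmarks
  landmark∈landmarks i = ∈-map⁺ landmark (∈-allFin i)

  landmarks-length : length landmarks ≡ K
  landmarks-length = ≡.trans (length-map landmark (allFin K)) (length-tabulate {n = K} id)

  landmarks-resolving : Resolving G landmarks
  landmarks-resolving u w same = x-injective λ i →
    just-injective (Dist-unique (same (landmark i) (landmark∈landmarks i) _ (dist-to-landmark u i))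
                                (dist-to-landmark w i))

  v : Point
  v = landmark zero

  onLayer? : ∀ u → Dec (x u zero ≡ j)
  onLayer? u = x u zero ℕ.≟ j

  layer : List Point
  layer = filter onLayer? (allFin _)

  layer-unique : Unique layer
  layer-unique = Unique.filter⁺ onLayer? (Unique.allFin⁺ _)

  ∈layer⇔AtDist : ∀ u → u ∈ layer ⇔ AtDist G v j u
  ∈layer⇔AtDist u = mk⇔
    (onLayer⇒AtDist ∘ proj₂ ∘ ∈-filter⁻ onLayer? {xs = allFin _})
    (λ (_ , dist) → ∈-filter⁺ onLayer? (∈-allFin u) (just-injective (Dist-unique (dist-to-landmark u zero) dist)))
    where
    onLayer⇒AtDist : x u zero ≡ j → AtDist G v j u
    onLayer⇒AtDist xᵤ≡j = u≢v , subst (λ d → Dist G u v (just d)) xᵤ≡j (dist-to-landmark u zero)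
      where
      u≢v : u ≢ v
      u≢v u≡v = 0≢1+n (begin
        0        ≡⟨ ≡.sym (x-landmark-self zero) ⟩
        x v zero ≡⟨ cong (λ w → x w zero) (≡.sym u≡v) ⟩
        x u zero ≡⟨ xᵤ≡j ⟩
        j        ∎)
        where open ≡.≡-Reasoning

  layer-upper-bound : length layer ≤ (2 * j + 1) ^ m
  layer-upper-bound = subst (λ k → length layer ≤ (2 * j + 1) ^ (k ∸ 1)) landmarks-length
                      (AtDistanceBound.atDist-bound v j landmarks-resolving (landmark∈landmarks zero) layer-unique
                         (All.tabulate λ {u} → Equivalence.to (∈layer⇔AtDist u)))

  slab : (Fin m → Fin (2 * j + 1)) → Fin K → ℕ
  slab g zero    = j
  slab g (suc l) = j + toℕ (g l)

  slab-offset≤E : (g : Fin m → Fin (2 * j + 1)) → ∀ l → toℕ (g l) ≤ E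
  slab-offset≤E g l = m<1+n⇒m≤n (subst (toℕ (g l) <_) (≡.sym (suc[j+j]≡2*j+1 j)) (toℕ<n (g l)))

  slab-valid : ∀ (g : Fin m → Fin (2 * j + 1)) → Valid (slab g)
  slab-valid g zero    zero    0≢0 = contradiction refl 0≢0
  slab-valid g zero    (suc l) _   = Tri-j (slab-offset≤E g l)
    where
    Tri-j : ∀ {c} → c ≤ E → Tri E j (j + c)
    Tri-j {c} c≤E = ≤-trans (m≤m+n j c) (m≤m+n _ E) , +-monoʳ-≤ j c≤E , +-monoʳ-≤ j (m≤m+n j c)
  slab-valid g (suc l) zero    l≢0 = Tri-sym (slab-valid g zero (suc l) (l≢0 ∘ ≡.sym))
  slab-valid g (suc l) (suc l′) _  =
    ≤-trans (+-monoʳ-≤ j (slab-offset≤E g l))  (+-monoˡ-≤ E (m≤m+n j _)) ,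
    ≤-trans (+-monoʳ-≤ j (slab-offset≤E g l′)) (+-monoˡ-≤ E (m≤m+n j _)) ,
    +-mono-≤ (m≤m+n j _) (m≤m+n j _)

  slab-bounded : ∀ (g : Fin m → Fin (2 * j + 1)) l → slab g l ≤ B
  slab-bounded g zero    = m≤n+m j E
  slab-bounded g (suc l) = ≤-trans (+-monoʳ-≤ j (slab-offset≤E g l)) (≤-reflexive (+-comm j E))

  layer-lower-bound : (2 * j + 1) ^ m ≤ length layer
  layer-lower-bound = injective⇒≤ {f = index ∘ in-layer} slab-injective
    where
    slab-point : (t : Fin ((2 * j + 1) ^ m)) → Σ[ u ∈ Point ] x u ≗ slab (finToFun t)
    slab-point t = point (slab (finToFun t)) (slab-bounded _) (slab-valid _)

    in-layer : (t : Fin ((2 * j + 1) ^ m)) → proj₁ (slab-point t) ∈ layer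
    in-layer t = ∈-filter⁺ onLayer? (∈-allFin _) (proj₂ (slab-point t) zero)

    slab-injective : Injective _≡_ _≡_ (index ∘ in-layer)
    slab-injective {t} {t′} eq = finToFun-injective λ l → toℕ-injective (+-cancelˡ-≡ j _ _ (begin
      j + toℕ (finToFun t l)  ≡⟨ ≡.sym (proj₂ (slab-point t) (suc l)) ⟩
      x (proj₁ (slab-point t)) (suc l)  ≡⟨ cong (λ w → x w (suc l)) same-point ⟩
      x (proj₁ (slab-point t′)) (suc l) ≡⟨ proj₂ (slab-point t′) (suc l) ⟩
      j + toℕ (finToFun t′ l) ∎))
      where
      open ≡.≡-Reasoning
      same-point : proj₁ (slab-point t) ≡ proj₁ (slab-point t′)
      same-point = ≡.trans (lookup-index (in-layer t))
                     (≡.trans (cong (lookup layer) eq) (≡.sym (lookup-index (in-layer t′))))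

  extremal : Σ[ G ∈ Graph ] Σ[ S ∈ List (Vertex G) ]
               (Unique S × length S ≡ K × Resolving G S ×
                (Σ[ v ∈ Vertex G ] (v ∈ S ×
                  (Σ[ L ∈ List (Vertex G) ] (Unique L × (∀ u → (u ∈ L ⇔ AtDist G v j u))
                    × length L ≡ (2 * j + 1) ^ (K ∸ 1))))))
  extremal = G , landmarks , landmarks-unique , landmarks-length
           , landmarks-resolving , v , landmark∈landmarks zero
           , layer , layer-unique , ∈layer⇔AtDist , ≤-antisym layer-upper-bound layer-lower-bound

theorem29 : (k j : ℕ) → .{{NonZero k}} → .{{NonZero j}} →
    ((G : Graph) (S : List (Vertex G)) → Unique S → length S ≡ k → Resolving G S →
      (v : Vertex G) → v ∈ S →
      (L : List (Vertex G)) → Unique L → All (AtDist G v j) L →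
      length L ≤ (2 * j + 1) ^ (k ∸ 1))
    × (Σ[ G ∈ Graph ] Σ[ S ∈ List (Vertex G) ]
        (Unique S × length S ≡ k × Resolving G S ×
         (Σ[ v ∈ Vertex G ] (v ∈ S ×
           (Σ[ L ∈ List (Vertex G) ] (Unique L × (∀ u → (u ∈ L ⇔ AtDist G v j u))
             × length L ≡ (2 * j + 1) ^ (k ∸ 1)))))))
theorem29 (suc m) j@(suc j′) =
  (λ G S _ |S|≡k resolving v v∈S L unique-L atDist-L →
     subst (λ n → length L ≤ (2 * j + 1) ^ (n ∸ 1)) |S|≡k
           (AtDistanceBound.atDist-bound v j resolving v∈S unique-L atDist-L))
  , Extremal.extremal m j′
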